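{- Let $n\ge 3$, let $G_n$ be the straight linear 2-tree on $n$ vertices and $m=n-2$. Then the resistance distance between vertices $1$ and $n$ is \[ r(1,n)=\frac{2F_{m+1}^2}{L_{m+1}L_m}+\sum_{i=1}^{m-1}\frac{F_iF_{i+1}}{L_iL_{i+1}}=\frac{m+1}{5}+\frac{4F_{m+1}}{5L_{m+1}}. \]
   Context: The straight linear 2-tree $G_n$ is the graph with vertex set $\{1,\dots,n\}$ in which $\{i,j\}$ is an edge if and only if $0<|i-j|\le 2$. Every edge is a unit resistor; resistance distance is $r(i,j)=(\mathbf e_i-\mathbf e_j)^TL^{\dagger}(\mathbf e_i-\mathbf e_j)$ with $L^\dagger$ the Moore–Penrose inverse of the Laplacian of $G_n$. $F_p$ are the Fibonacci numbers ($F_0=0,F_1=1,F_{p+1}=F_p+F_{p-1}$) and $L_p=F_{p-1}+F_{p+1}$ are the Lucas numbers. -}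

module Defs where

open import Data.Nat as ℕ using (ℕ; zero; suc; NonZero)
open import Data.Nat.Properties using (m*n≢0)
open import Data.Fin using (Fin; toℕ)
open import Data.Bool using (Bool; true; false; if_then_else_)
open import Data.Integer using (+_)
open import Data.Rational using (ℚ; 0ℚ; 1ℚ; _+_; _*_; -_; _-_; _/_)
import Data.Rational as ℚ
open import Relation.Binary.PropositionalEquality using (_≡_)
open import Relation.Nullary.Decidable using (⌊_⌋)
open import Data.Fin using (_≟_)

fib : ℕ → ℕ
fib zero = 0
fib (suc zero) = 1
fib (suc (suc p)) = fib (suc p) ℕ.+ fib p

-- Lucas numbers L_p = F_{p-1} + F_{p+1}  (with F_{-1} = 1, so L_0 = 2)
lucas : ℕ → ℕ
lucas zero = 2
lucas (suc p) = fib p ℕ.+ fib (suc (suc p))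

fib-suc-pos : ∀ p → NonZero (fib (suc p))
fib-suc-pos zero = _
fib-suc-pos (suc p) = +-nz (fib (suc p)) (fib p) (fib-suc-pos p)
  where
  +-nz : ∀ a b → NonZero a → NonZero (a ℕ.+ b)
  +-nz (suc a) b _ = _

lucas-nonZero : ∀ p → NonZero (lucas p)
lucas-nonZero zero = _
lucas-nonZero (suc p) = nz (fib p) (fib (suc (suc p))) (fib-suc-pos (suc p))
  where
  nz : ∀ a b → NonZero b → NonZero (a ℕ.+ b)
  nz zero (suc b) _ = _
  nz (suc a) b _ = _

lucas*lucas-nonZero : ∀ p q → NonZero (lucas p ℕ.* lucas q)
lucas*lucas-nonZero p q = m*n≢0 (lucas p) (lucas q) {{lucas-nonZero p}} {{lucas-nonZero q}}

five*lucas-nonZero : ∀ p → NonZero (5 ℕ.* lucas p)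
five*lucas-nonZero p = m*n≢0 5 (lucas p) {{_}} {{lucas-nonZero p}}

frac : (a b : ℕ) → NonZero b → ℚ
frac a b nz = ((+ a) / b) {{nz}}

sumFin : (n : ℕ) → (Fin n → ℚ) → ℚ
sumFin zero f = 0ℚ
sumFin (suc n) f = f Fin.zero + sumFin n (λ i → f (Fin.suc i))
  where import Data.Fin as Fin

sumFrom1 : ℕ → (ℕ → ℚ) → ℚ
sumFrom1 zero f = 0ℚ
sumFrom1 (suc u) f = sumFrom1 u f + f (suc u)

Matrix : ℕ → Set
Matrix n = Fin n → Fin n → ℚ

_·_ : ∀ {n} → Matrix n → Matrix n → Matrix n
(A · B) i j = sumFin _ (λ k → A i k * B k j)

transpose : ∀ {n} → Matrix n → Matrix n
transpose A i j = A j i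

dist : ℕ → ℕ → ℕ
dist a b = (a ℕ.∸ b) ℕ.+ (b ℕ.∸ a)

-- adjacency of the straight linear 2-tree G_n: {i,j} edge iff 0 < |i-j| ≤ 2
-- (vertices 1..n are represented by Fin n, vertex v ↦ index v-1)
adj : ∀ {n} → Fin n → Fin n → Bool
adj i j = ⌊ 1 ℕ.≤? dist (toℕ i) (toℕ j) ⌋ Data.Bool.∧ ⌊ dist (toℕ i) (toℕ j) ℕ.≤? 2 ⌋
  where import Data.Bool

adjℚ : ∀ {n} → Fin n → Fin n → ℚ
adjℚ i j = if adj i j then 1ℚ else 0ℚ

degree : ∀ {n} → Fin n → ℚ
degree {n} i = sumFin n (λ j → adjℚ i j)

laplacian : (n : ℕ) → Matrix n
laplacian n i j = if ⌊ i ≟ j ⌋ then degree i else - adjℚ i j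

record IsMoorePenroseInverse {n : ℕ} (A M : Matrix n) : Set where
  field
    penrose1 : ∀ i j → ((A · M) · A) i j ≡ A i j
    penrose2 : ∀ i j → ((M · A) · M) i j ≡ M i j
    penrose3 : ∀ i j → transpose (A · M) i j ≡ (A · M) i j
    penrose4 : ∀ i j → transpose (M · A) i j ≡ (M · A) i j

e : ∀ {n} → Fin n → Fin n → ℚ
e i k = if ⌊ i ≟ k ⌋ then 1ℚ else 0ℚ

quadForm : ∀ {n} → Matrix n → (Fin n → ℚ) → ℚ
quadForm {n} M v = sumFin n (λ a → sumFin n (λ b → v a * M a b * v b))

resistance : ∀ {n} → Matrix n → Fin n → Fin n → ℚ
resistance Ldag i j = quadForm Ldag (λ k → e i k - e j k)

-- Let n = N + 1 and index a vertex by the pair (s , r) of its distances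
-- to the two ends, so s + r = N.  The potential
--   Y(s , r) = − s L_N + 2 (F_r F_{s+1} − F_{r+1} F_s)
-- satisfies L Y = 5 L_N (e₁ − e_n): at each vertex this becomes a polynomial
-- identity once the Fibonacci numbers near s and near r are expanded in two
-- consecutive ones.  Since L L† L = L, the resistance is (Y(0 , N) − Y(N , 0)) / (5 L_N)
-- = N/5 + 4F_N/(5L_N).  The series form follows by induction on m, each step
-- being a polynomial identity in k, F_k, F_{k+1} after clearing denominators.
module Submission where

open import Defs
open import Data.Nat using (ℕ; zero; suc; NonZero; _∸_)
open import Data.Fin using (Fin; zero; suc; fromℕ; toℕ)
open import Data.Rational using (ℚ; 0ℚ; 1ℚ; _+_; _*_; -_; _-_; toℚᵘ)
open import Data.Product using (_×_; _,_; proj₁; proj₂)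
open import Relation.Binary.PropositionalEquality using (_≡_; refl; sym; trans; cong; cong₂; module ≡-Reasoning)

open import Algebra.Bundles using (Ring)
open import Algebra.Bundles.Raw using (RawRing; RawSemiring)
open import Data.Bool using (true; false; _∧_; if_then_else_)
open import Data.Empty using (⊥-elim)
import Data.Fin as Fin
import Data.Fin.Properties as FinP
import Data.Integer as ℤ
import Data.Integer.Properties as ℤP
import Data.Nat as ℕ
import Data.Nat.Properties as ℕP
import Data.Nat.Solver as ℕ-Solver
import Data.Rational.Properties as ℚP
open import Data.Rational.Solver using (module +-*-Solver)
open import Data.Rational.Unnormalised as ℚᵘ using (mkℚᵘ; _≃_; *≡*)
import Data.Rational.Unnormalised.Properties as ℚᵘP
open import Level using (0ℓ)
open import Relation.Nullary using (yes; no; _because_)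
open import Relation.Nullary.Decidable using (⌊_⌋)
open import Algebra.Properties.Semiring.Sum (Ring.semiring ℚP.+-*-ring)
  using (sum; sum-cong-≗; ∑-comm; ∑-distrib-+; *-distribˡ-sum; *-distribʳ-sum)

open +-*-Solver

-- Fractions of natural numbers

*-nonZero : ∀ {m n} → NonZero m → NonZero n → NonZero (m ℕ.* n)
*-nonZero {m} {n} nm nn = ℕP.m*n≢0 m n {{nm}} {{nn}}

toℚᵘ-frac : ∀ a b {nb : NonZero (suc b)} → toℚᵘ (frac a (suc b) nb) ≃ mkℚᵘ (ℤ.+ a) b
toℚᵘ-frac a b = ℚP.toℚᵘ-fromℚᵘ (mkℚᵘ (ℤ.+ a) b)

frac-cross : ∀ a b c d nb nd → a ℕ.* d ≡ c ℕ.* b → frac a b nb ≡ frac c d nd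
frac-cross a (suc b) c (suc d) _ _ eq = ℚP.toℚᵘ-injective (begin
  toℚᵘ (frac a (suc b) _) ≈⟨ toℚᵘ-frac a b ⟩
  mkℚᵘ (ℤ.+ a) b          ≈⟨ *≡* (trans (sym (ℤP.pos-* a (suc d))) (trans (cong ℤ.+_ eq) (ℤP.pos-* c (suc b)))) ⟩
  mkℚᵘ (ℤ.+ c) d          ≈⟨ ℚᵘP.≃-sym (toℚᵘ-frac c d) ⟩
  toℚᵘ (frac c (suc d) _) ∎)
  where open ℚᵘP.≃-Reasoning

frac-+ : ∀ a b c d nb nd → frac a b nb + frac c d nd ≡ frac (a ℕ.* d ℕ.+ c ℕ.* b) (b ℕ.* d) (*-nonZero nb nd)
frac-+ a (suc b) c (suc d) _ _ = ℚP.toℚᵘ-injective (begin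
  toℚᵘ (frac a (suc b) _ + frac c (suc d) _)           ≈⟨ ℚP.toℚᵘ-homo-+ (frac a (suc b) _) (frac c (suc d) _) ⟩
  toℚᵘ (frac a (suc b) _) ℚᵘ.+ toℚᵘ (frac c (suc d) _) ≈⟨ ℚᵘP.+-cong (toℚᵘ-frac a b) (toℚᵘ-frac c d) ⟩
  mkℚᵘ (ℤ.+ a) b ℚᵘ.+ mkℚᵘ (ℤ.+ c) d                  ≡⟨ cong (λ z → mkℚᵘ z _) numerator ⟩
  mkℚᵘ (ℤ.+ (a ℕ.* suc d ℕ.+ c ℕ.* suc b)) _           ≈⟨ ℚᵘP.≃-sym (toℚᵘ-frac _ _) ⟩
  toℚᵘ (frac (a ℕ.* suc d ℕ.+ c ℕ.* suc b) (suc b ℕ.* suc d) _) ∎)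
  where
  open ℚᵘP.≃-Reasoning
  numerator : ℤ.+ a ℤ.* ℤ.+ suc d ℤ.+ ℤ.+ c ℤ.* ℤ.+ suc b ≡ ℤ.+ (a ℕ.* suc d ℕ.+ c ℕ.* suc b)
  numerator = trans (cong₂ ℤ._+_ (sym (ℤP.pos-* a (suc d))) (sym (ℤP.pos-* c (suc b))))
                    (sym (ℤP.pos-+ (a ℕ.* suc d) (c ℕ.* suc b)))

frac-* : ∀ a b c d nb nd → frac a b nb * frac c d nd ≡ frac (a ℕ.* c) (b ℕ.* d) (*-nonZero nb nd)
frac-* a (suc b) c (suc d) _ _ = ℚP.toℚᵘ-injective (begin
  toℚᵘ (frac a (suc b) _ * frac c (suc d) _)           ≈⟨ ℚP.toℚᵘ-homo-* (frac a (suc b) _) (frac c (suc d) _) ⟩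
  toℚᵘ (frac a (suc b) _) ℚᵘ.* toℚᵘ (frac c (suc d) _) ≈⟨ ℚᵘP.*-cong (toℚᵘ-frac a b) (toℚᵘ-frac c d) ⟩
  mkℚᵘ (ℤ.+ a) b ℚᵘ.* mkℚᵘ (ℤ.+ c) d                  ≡⟨ cong (λ z → mkℚᵘ z _) (sym (ℤP.pos-* a c)) ⟩
  mkℚᵘ (ℤ.+ (a ℕ.* c)) _                               ≈⟨ ℚᵘP.≃-sym (toℚᵘ-frac _ _) ⟩
  toℚᵘ (frac (a ℕ.* c) (suc b ℕ.* suc d) _)            ∎)
  where open ℚᵘP.≃-Reasoning

ι : ℕ → ℚ
ι n = frac n 1 _

ι-homo-+ : ∀ m n → ι (m ℕ.+ n) ≡ ι m + ι n
ι-homo-+ m n = sym (trans (frac-+ m 1 n 1 _ _) (frac-cross (m ℕ.* 1 ℕ.+ n ℕ.* 1) 1 (m ℕ.+ n) 1 _ _ eq))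
  where
  eq : (m ℕ.* 1 ℕ.+ n ℕ.* 1) ℕ.* 1 ≡ (m ℕ.+ n) ℕ.* 1
  eq = cong (ℕ._* 1) (cong₂ ℕ._+_ (ℕP.*-identityʳ m) (ℕP.*-identityʳ n))

ι-homo-* : ∀ m n → ι (m ℕ.* n) ≡ ι m * ι n
ι-homo-* m n = sym (frac-* m 1 n 1 _ _)

frac-1-*-ι : ∀ a d nd → frac 1 d nd * ι a ≡ frac a d nd
frac-1-*-ι a d nd = trans (frac-* 1 d a 1 nd _) (frac-cross (1 ℕ.* a) (d ℕ.* 1) a d (*-nonZero nd _) nd eq)
  where
  eq : 1 ℕ.* a ℕ.* d ≡ a ℕ.* (d ℕ.* 1)
  eq = cong₂ ℕ._*_ (ℕP.*-identityˡ a) (sym (ℕP.*-identityʳ d))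

-- Finite sums, and the quadratic form of a pseudoinverse

sumFin≡sum : ∀ n (f : Fin n → ℚ) → sumFin n f ≡ sum f
sumFin≡sum zero f = refl
sumFin≡sum (suc n) f = cong (f zero +_) (sumFin≡sum n (λ i → f (suc i)))

∑-0* : ∀ {n} (f : Fin n → ℚ) → sum (λ j → 0ℚ * f j) ≡ 0ℚ
∑-0* f = trans (sym (*-distribˡ-sum 0ℚ f)) (ℚP.*-zeroˡ (sum f))

∑-distrib-- : ∀ {n} (f g : Fin n → ℚ) → sum (λ j → f j - g j) ≡ sum f - sum g
∑-distrib-- f g = begin
  sum (λ j → f j - g j)            ≡⟨ ∑-distrib-+ f (λ j → - g j) ⟩
  sum f + sum (λ j → - g j)        ≡⟨ cong (sum f +_) (sum-cong-≗ λ j → -‿≡-1* (g j)) ⟩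
  sum f + sum (λ j → (- 1ℚ) * g j) ≡⟨ cong (sum f +_) (sym (*-distribˡ-sum (- 1ℚ) g)) ⟩
  sum f + (- 1ℚ) * sum g           ≡⟨ cong (sum f +_) (sym (-‿≡-1* (sum g))) ⟩
  sum f - sum g                    ∎
  where
  open ≡-Reasoning
  -‿≡-1* : ∀ x → - x ≡ (- 1ℚ) * x
  -‿≡-1* = solve 1 (λ x → :- x := con (- 1ℚ) :* x) refl

e-suc : ∀ {n} (i j : Fin n) → e {suc n} (suc i) (suc j) ≡ e i j
e-suc i j with i Fin.≟ j
... | true because _ = refl
... | false because _ = refl

∑-δ : ∀ {n} (i : Fin n) (f : Fin n → ℚ) → sum (λ j → e i j * f j) ≡ f i
∑-δ zero f = trans (cong₂ _+_ (ℚP.*-identityˡ (f zero)) (∑-0* (λ j → f (suc j)))) (ℚP.+-identityʳ (f zero))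
∑-δ (suc i) f = begin
  0ℚ * f zero + sum (λ j → e (suc i) (suc j) * f (suc j))
    ≡⟨ cong₂ _+_ (ℚP.*-zeroˡ (f zero)) (sum-cong-≗ λ j → cong (_* f (suc j)) (e-suc i j)) ⟩
  0ℚ + sum (λ j → e i j * f (suc j)) ≡⟨ ℚP.+-identityˡ _ ⟩
  sum (λ j → e i j * f (suc j))      ≡⟨ ∑-δ i (λ j → f (suc j)) ⟩
  f (suc i)                          ∎
  where open ≡-Reasoning

module _ {n : ℕ} where

  _*ᵥ_ : Matrix n → (Fin n → ℚ) → Fin n → ℚ
  (A *ᵥ v) i = sum λ j → A i j * v j

  ⟨_,_⟩ : (Fin n → ℚ) → (Fin n → ℚ) → ℚ
  ⟨ u , v ⟩ = sum λ i → u i * v i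

  ⟨,⟩-cong : ∀ {u u′ v v′} → (∀ i → u i ≡ u′ i) → (∀ i → v i ≡ v′ i) → ⟨ u , v ⟩ ≡ ⟨ u′ , v′ ⟩
  ⟨,⟩-cong u≗u′ v≗v′ = sum-cong-≗ λ i → cong₂ _*_ (u≗u′ i) (v≗v′ i)

  ⟨,⟩-congʳ : ∀ u {v v′} → (∀ i → v i ≡ v′ i) → ⟨ u , v ⟩ ≡ ⟨ u , v′ ⟩
  ⟨,⟩-congʳ u = ⟨,⟩-cong {u} (λ _ → refl)

  ⟨,e-e⟩ : ∀ u i j → ⟨ u , (λ k → e i k - e j k) ⟩ ≡ u i - u j
  ⟨,e-e⟩ u i j = begin
    sum (λ k → u k * (e i k - e j k))             ≡⟨ sum-cong-≗ (λ k → solve 3 (λ x a b → x :* (a :- b) := a :* x :- b :* x) refl (u k) (e i k) (e j k)) ⟩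
    sum (λ k → e i k * u k - e j k * u k)         ≡⟨ ∑-distrib-- (λ k → e i k * u k) (λ k → e j k * u k) ⟩
    sum (λ k → e i k * u k) - sum (λ k → e j k * u k) ≡⟨ cong₂ _-_ (∑-δ i u) (∑-δ j u) ⟩
    u i - u j                                     ∎
    where open ≡-Reasoning

  *ᵥ-*ˡ : ∀ A c v i → (A *ᵥ (λ j → c * v j)) i ≡ c * (A *ᵥ v) i
  *ᵥ-*ˡ A c v i = trans (sum-cong-≗ λ j → solve 3 (λ a c x → a :* (c :* x) := c :* (a :* x)) refl (A i j) c (v j))
                        (sym (*-distribˡ-sum c (λ j → A i j * v j)))

  quadForm≡⟨,⟩ : ∀ M v → quadForm M v ≡ ⟨ v , M *ᵥ v ⟩
  quadForm≡⟨,⟩ M v = begin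
    sumFin n (λ a → sumFin n λ b → v a * M a b * v b) ≡⟨ sumFin≡sum n (λ a → sumFin n λ b → v a * M a b * v b) ⟩
    sum (λ a → sumFin n λ b → v a * M a b * v b)      ≡⟨ sum-cong-≗ (λ a → sumFin≡sum n λ b → v a * M a b * v b) ⟩
    sum (λ a → sum λ b → v a * M a b * v b)           ≡⟨ sum-cong-≗ (λ a → sum-cong-≗ λ b → ℚP.*-assoc (v a) (M a b) (v b)) ⟩
    sum (λ a → sum λ b → v a * (M a b * v b))         ≡⟨ sum-cong-≗ (λ a → sym (*-distribˡ-sum (v a) (λ b → M a b * v b))) ⟩
    ⟨ v , M *ᵥ v ⟩                                    ∎
    where open ≡-Reasoning

  ·-*ᵥ : ∀ A B v i → ((A · B) *ᵥ v) i ≡ (A *ᵥ (B *ᵥ v)) i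
  ·-*ᵥ A B v i = begin
    sum (λ j → sumFin n (λ k → A i k * B k j) * v j) ≡⟨ sum-cong-≗ (λ j → cong (_* v j) (sumFin≡sum n (λ k → A i k * B k j))) ⟩
    sum (λ j → sum (λ k → A i k * B k j) * v j)      ≡⟨ sum-cong-≗ (λ j → *-distribʳ-sum (v j) (λ k → A i k * B k j)) ⟩
    sum (λ j → sum λ k → A i k * B k j * v j)        ≡⟨ ∑-comm (λ j k → A i k * B k j * v j) ⟩
    sum (λ k → sum λ j → A i k * B k j * v j)        ≡⟨ sum-cong-≗ (λ k → sum-cong-≗ λ j → ℚP.*-assoc (A i k) (B k j) (v j)) ⟩
    sum (λ k → sum λ j → A i k * (B k j * v j))      ≡⟨ sum-cong-≗ (λ k → sym (*-distribˡ-sum (A i k) (λ j → B k j * v j))) ⟩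
    (A *ᵥ (B *ᵥ v)) i                                ∎
    where open ≡-Reasoning

  ⟨*ᵥ,⟩-symmetric : ∀ A → (∀ i j → A i j ≡ A j i) → ∀ u v → ⟨ A *ᵥ u , v ⟩ ≡ ⟨ u , A *ᵥ v ⟩
  ⟨*ᵥ,⟩-symmetric A A-sym u v = begin
    sum (λ i → sum (λ j → A i j * u j) * v i) ≡⟨ sum-cong-≗ (λ i → *-distribʳ-sum (v i) (λ j → A i j * u j)) ⟩
    sum (λ i → sum λ j → A i j * u j * v i)   ≡⟨ ∑-comm (λ i j → A i j * u j * v i) ⟩
    sum (λ j → sum λ i → A i j * u j * v i)   ≡⟨ sum-cong-≗ (λ j → sum-cong-≗ λ i → swap (A-sym i j)) ⟩
    sum (λ j → sum λ i → u j * (A j i * v i)) ≡⟨ sum-cong-≗ (λ j → sym (*-distribˡ-sum (u j) (λ i → A j i * v i))) ⟩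
    ⟨ u , A *ᵥ v ⟩                            ∎
    where
    open ≡-Reasoning
    swap : ∀ {a a′ x y} → a ≡ a′ → a * x * y ≡ x * (a′ * y)
    swap {a} {_} {x} {y} refl = solve 3 (λ a x y → a :* x :* y := x :* (a :* y)) refl a x y

  quadForm-pseudoinverse : ∀ (L M : Matrix n) (x b : Fin n → ℚ) → (∀ i j → L i j ≡ L j i)
    → (∀ i j → ((L · M) · L) i j ≡ L i j) → (∀ i → (L *ᵥ x) i ≡ b i) → quadForm M b ≡ ⟨ x , b ⟩
  quadForm-pseudoinverse L M x b L-sym LML≡L Lx≡b = begin
    quadForm M b                 ≡⟨ quadForm≡⟨,⟩ M b ⟩
    ⟨ b , M *ᵥ b ⟩               ≡⟨ ⟨,⟩-cong {b} {L *ᵥ x} (λ i → sym (Lx≡b i)) (λ i → sym (sum-cong-≗ λ j → cong (M i j *_) (Lx≡b j))) ⟩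
    ⟨ L *ᵥ x , M *ᵥ (L *ᵥ x) ⟩   ≡⟨ ⟨*ᵥ,⟩-symmetric L L-sym x (M *ᵥ (L *ᵥ x)) ⟩
    ⟨ x , L *ᵥ (M *ᵥ (L *ᵥ x)) ⟩ ≡⟨ ⟨,⟩-congʳ x (λ i → sym (trans (·-*ᵥ (L · M) L x i) (·-*ᵥ L M (L *ᵥ x) i))) ⟩
    ⟨ x , ((L · M) · L) *ᵥ x ⟩   ≡⟨ ⟨,⟩-congʳ x (λ i → sum-cong-≗ λ j → cong (_* x j) (LML≡L i j)) ⟩
    ⟨ x , L *ᵥ x ⟩               ≡⟨ ⟨,⟩-congʳ x Lx≡b ⟩
    ⟨ x , b ⟩                    ∎
    where open ≡-Reasoning

-- The Laplacian of the straight linear 2-tree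

-- adjℚ i j unfolds to band (toℕ i) (toℕ j), so row sums can be computed over ℕ.
band : ℕ → ℕ → ℚ
band s t = if ⌊ 1 ℕ.≤? dist s t ⌋ ∧ ⌊ dist s t ℕ.≤? 2 ⌋ then 1ℚ else 0ℚ

band-sym : ∀ s t → band s t ≡ band t s
band-sym s t = cong (λ d → if ⌊ 1 ℕ.≤? d ⌋ ∧ ⌊ d ℕ.≤? 2 ⌋ then 1ℚ else 0ℚ) (ℕP.+-comm (s ∸ t) (t ∸ s))

band-refl : ∀ s → band s s ≡ 0ℚ
band-refl s rewrite ℕP.n∸n≡0 s = refl

laplacian-sym : ∀ n (i j : Fin n) → laplacian n i j ≡ laplacian n j i
laplacian-sym n i j with i Fin.≟ j | j Fin.≟ i
... | yes refl | yes _    = refl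
... | yes i≡j  | no j≢i   = ⊥-elim (j≢i (sym i≡j))
... | no i≢j   | yes j≡i  = ⊥-elim (i≢j (sym j≡i))
... | no _     | no _     = cong -_ (band-sym (toℕ i) (toℕ j))

laplacian-entry : ∀ {n} (x : Fin n → ℚ) (i j : Fin n) → laplacian n i j * x j ≡ e i j * (degree i * x i) - adjℚ i j * x j
laplacian-entry x i j with i Fin.≟ j
... | yes refl = trans (solve 2 (λ d y → d :* y := con 1ℚ :* (d :* y) :- con 0ℚ :* y) refl (degree i) (x i))
                       (cong (λ a → 1ℚ * (degree i * x i) - a * x i) (sym (band-refl (toℕ i))))
... | no _     = solve 3 (λ a d y → :- a :* y := con 0ℚ :* d :- a :* y) refl (adjℚ i j) (degree i * x i) (x j)

laplacian-*ᵥ : ∀ {n} (x : Fin n → ℚ) (i : Fin n) → (laplacian n *ᵥ x) i ≡ sum (λ j → adjℚ i j * (x i - x j))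
laplacian-*ᵥ {n} x i = begin
  sum (λ j → laplacian n i j * x j)                         ≡⟨ sum-cong-≗ (laplacian-entry x i) ⟩
  sum (λ j → e i j * (degree i * x i) - adjℚ i j * x j)     ≡⟨ ∑-distrib-- (λ j → e i j * (degree i * x i)) (λ j → adjℚ i j * x j) ⟩
  sum (λ j → e i j * (degree i * x i)) - sum (λ j → adjℚ i j * x j)
    ≡⟨ cong (_- sum (λ j → adjℚ i j * x j)) (trans (∑-δ i (λ _ → degree i * x i)) (cong (_* x i) (sumFin≡sum n (adjℚ i)))) ⟩
  sum (adjℚ i) * x i - sum (λ j → adjℚ i j * x j)           ≡⟨ cong (_- sum (λ j → adjℚ i j * x j)) (*-distribʳ-sum (x i) (adjℚ i)) ⟩
  sum (λ j → adjℚ i j * x i) - sum (λ j → adjℚ i j * x j)   ≡⟨ sym (∑-distrib-- (λ j → adjℚ i j * x i) (λ j → adjℚ i j * x j)) ⟩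
  sum (λ j → adjℚ i j * x i - adjℚ i j * x j)               ≡⟨ sum-cong-≗ (λ j → solve 3 (λ a u v → a :* u :- a :* v := a :* (u :- v)) refl (adjℚ i j) (x i) (x j)) ⟩
  sum (λ j → adjℚ i j * (x i - x j))                        ∎
  where open ≡-Reasoning

below : ℕ → (ℕ → ℚ) → ℚ
below zero          h = 0ℚ
below (suc zero)    h = h 0
below (suc (suc s)) h = h s + h (suc s)

above : ℕ → (ℕ → ℚ) → ℚ
above zero          g = 0ℚ
above (suc zero)    g = g 1
above (suc (suc r)) g = g 1 + g 2

sum-band-above : ∀ r (g : ℕ → ℚ) → sum {suc r} (λ j → band 0 (toℕ j) * g (toℕ j)) ≡ above r g
sum-band-above zero          g = solve 1 (λ a → con 0ℚ :* a :+ con 0ℚ := con 0ℚ) refl (g 0)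
sum-band-above (suc zero)    g = solve 2 (λ a b → con 0ℚ :* a :+ (con 1ℚ :* b :+ con 0ℚ) := b) refl (g 0) (g 1)
sum-band-above (suc (suc r)) g =
  trans (cong (λ z → 0ℚ * g 0 + (1ℚ * g 1 + (1ℚ * g 2 + z))) (∑-0* {r} (λ j → g (3 ℕ.+ toℕ j))))
        (solve 3 (λ a b c → con 0ℚ :* a :+ (con 1ℚ :* b :+ (con 1ℚ :* c :+ con 0ℚ)) := b :+ c) refl (g 0) (g 1) (g 2))

below-suc : ∀ s (h : ℕ → ℚ) → band (suc s) 0 * h 0 + below s (λ t → h (suc t)) ≡ below (suc s) h
below-suc zero          h = solve 1 (λ a → con 1ℚ :* a :+ con 0ℚ := a) refl (h 0)
below-suc (suc zero)    h = solve 2 (λ a b → con 1ℚ :* a :+ b := a :+ b) refl (h 0) (h 1)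
below-suc (suc (suc s)) h = solve 2 (λ a b → con 0ℚ :* a :+ b := b) refl (h 0) (h (suc s) + h (suc (suc s)))

above-cong : ∀ r {g g′ : ℕ → ℚ} → g 1 ≡ g′ 1 → g 2 ≡ g′ 2 → above r g ≡ above r g′
above-cong zero          _   _   = refl
above-cong (suc zero)    g₁≡ _   = g₁≡
above-cong (suc (suc r)) g₁≡ g₂≡ = cong₂ _+_ g₁≡ g₂≡

sum-band : ∀ s r {N} → s ℕ.+ r ≡ N → (h : ℕ → ℚ)
  → sum {suc N} (λ j → band s (toℕ j) * h (toℕ j)) ≡ below s h + above r (λ t → h (t ℕ.+ s))
sum-band zero    r refl h = trans (sum-band-above r h) (trans (above-cong r refl refl) (sym (ℚP.+-identityˡ _)))
sum-band (suc s) r refl h = begin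
  band (suc s) 0 * h 0 + sum {suc (s ℕ.+ r)} (λ j → band s (toℕ j) * h (suc (toℕ j)))
    ≡⟨ cong (band (suc s) 0 * h 0 +_) (sum-band s r refl (λ t → h (suc t))) ⟩
  band (suc s) 0 * h 0 + (below s (λ t → h (suc t)) + above r (λ t → h (suc (t ℕ.+ s))))
    ≡⟨ sym (ℚP.+-assoc (band (suc s) 0 * h 0) _ _) ⟩
  band (suc s) 0 * h 0 + below s (λ t → h (suc t)) + above r (λ t → h (suc (t ℕ.+ s)))
    ≡⟨ cong₂ _+_ (below-suc s h) (above-cong r refl refl) ⟩
  below (suc s) h + above r (λ t → h (t ℕ.+ suc s)) ∎
  where open ≡-Reasoning

-- Fibonacci charts and the potential

fibFrom : ∀ {a} {A : Set a} → (A → A → A) → A → A → ℕ → A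
fibFrom _⊕_ a b zero          = a
fibFrom _⊕_ a b (suc zero)    = b
fibFrom _⊕_ a b (suc (suc j)) = fibFrom _⊕_ a b (suc j) ⊕ fibFrom _⊕_ a b j

lucasFrom : ∀ {a} {A : Set a} → (A → A → A) → A → A → ℕ → A
lucasFrom _⊕_ a b j = fibFrom _⊕_ a b j ⊕ fibFrom _⊕_ a b (2 ℕ.+ j)

-- Stated over a raw ring so that the same formulas are read both in ℚ and as
-- polynomials for the ring solver.  A vertex of G_{s+r+1} is indexed by the
-- pair (s , r) of its distances to the two ends, and Δ f s r is the Laplacian
-- of f at (s , r).
module PathFormulas {c l} (R : RawRing c l) (ι′ : ℕ → RawRing.Carrier R) where
  open RawRing R using (Carrier; 0#) renaming (_+_ to _⊕_; _*_ to _⊛_; -_ to ⊝_)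

  private
    infixl 6 _⊖_
    _⊖_ : Carrier → Carrier → Carrier
    x ⊖ y = x ⊕ ⊝ y

  potentialFormula : (ℓ σ x y u v : Carrier) → Carrier
  potentialFormula ℓ σ x y u v = ⊝ (σ ⊛ ℓ) ⊕ ι′ 2 ⊛ (u ⊛ y ⊖ v ⊛ x)

  Δ↓ : (ℕ → ℕ → Carrier) → ℕ → ℕ → Carrier
  Δ↓ f zero          r = 0#
  Δ↓ f (suc zero)    r = f 1 r ⊖ f 0 (suc r)
  Δ↓ f (suc (suc p)) r = (f (2 ℕ.+ p) r ⊖ f p (2 ℕ.+ r)) ⊕ (f (2 ℕ.+ p) r ⊖ f (suc p) (suc r))

  Δ↑ : (ℕ → ℕ → Carrier) → ℕ → ℕ → Carrier
  Δ↑ f s zero          = 0#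
  Δ↑ f s (suc zero)    = f s 1 ⊖ f (suc s) 0
  Δ↑ f s (suc (suc q)) = (f s (2 ℕ.+ q) ⊖ f (suc s) (suc q)) ⊕ (f s (2 ℕ.+ q) ⊖ f (2 ℕ.+ s) q)

  Δ : (ℕ → ℕ → Carrier) → ℕ → ℕ → Carrier
  Δ f s r = Δ↓ f s r ⊕ Δ↑ f s r

  -- The potential at (j + p , k + q) once F_{j+p} and F_{k+q} are expanded
  -- from (a , b) = (F_p , F_{p+1}) and (c , d) = (F_q , F_{q+1}), with σ = p.
  chart : (ℓ σ a b c d : Carrier) → ℕ → ℕ → Carrier
  chart ℓ σ a b c d j k = potentialFormula ℓ (ι′ j ⊕ σ) (fibFrom _⊕_ a b j) (fibFrom _⊕_ a b (suc j)) (fibFrom _⊕_ c d k) (fibFrom _⊕_ c d (suc k))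

ℚ-polynomialRing : ℕ → RawRing 0ℓ 0ℓ
ℚ-polynomialRing n = record
  { Carrier = Polynomial n ; _≈_ = _≡_ ; _+_ = _:+_ ; _*_ = _:*_ ; -_ = :-_ ; 0# = con 0ℚ ; 1# = con 1ℚ }

module Q = PathFormulas ℚP.+-*-rawRing ι
module P {n} = PathFormulas (ℚ-polynomialRing n) (λ j → con (ι j))

ι-fib-+ : ∀ j p → ι (fib (j ℕ.+ p)) ≡ fibFrom _+_ (ι (fib p)) (ι (fib (suc p))) j
ι-fib-+ zero          p = refl
ι-fib-+ (suc zero)    p = refl
ι-fib-+ (suc (suc j)) p = trans (ι-homo-+ (fib (suc (j ℕ.+ p))) (fib (j ℕ.+ p))) (cong₂ _+_ (ι-fib-+ (suc j) p) (ι-fib-+ j p))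

ι-lucas-+ : ∀ j q → ι (lucas (suc (j ℕ.+ q))) ≡ lucasFrom _+_ (ι (fib q)) (ι (fib (suc q))) j
ι-lucas-+ j q = trans (ι-homo-+ (fib (j ℕ.+ q)) (fib (2 ℕ.+ j ℕ.+ q))) (cong₂ _+_ (ι-fib-+ j q) (ι-fib-+ (2 ℕ.+ j) q))

potential : ℚ → ℕ → ℕ → ℚ
potential ℓ s r = Q.potentialFormula ℓ (ι s) (ι (fib s)) (ι (fib (suc s))) (ι (fib r)) (ι (fib (suc r)))

potential-chart : ∀ ℓ p q j k → potential ℓ (j ℕ.+ p) (k ℕ.+ q) ≡ Q.chart ℓ (ι p) (ι (fib p)) (ι (fib (suc p))) (ι (fib q)) (ι (fib (suc q))) j k
potential-chart ℓ p q j k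
  rewrite ι-homo-+ j p | ι-fib-+ j p | ι-fib-+ (suc j) p | ι-fib-+ k q | ι-fib-+ (suc k) q = refl

Δ-cong : ∀ {f g : ℕ → ℕ → ℚ} → (∀ t u → f t u ≡ g t u) → ∀ s r → Q.Δ f s r ≡ Q.Δ g s r
Δ-cong {f} {g} f≗g s r = cong₂ _+_ (Δ↓-cong s) (Δ↑-cong r)
  where
  -cong : ∀ t u t′ u′ → f t u - f t′ u′ ≡ g t u - g t′ u′
  -cong t u t′ u′ = cong₂ _-_ (f≗g t u) (f≗g t′ u′)
  Δ↓-cong : ∀ s → Q.Δ↓ f s r ≡ Q.Δ↓ g s r
  Δ↓-cong zero          = refl
  Δ↓-cong (suc zero)    = -cong _ _ _ _
  Δ↓-cong (suc (suc p)) = cong₂ _+_ (-cong _ _ _ _) (-cong _ _ _ _)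
  Δ↑-cong : ∀ r → Q.Δ↑ f s r ≡ Q.Δ↑ g s r
  Δ↑-cong zero          = refl
  Δ↑-cong (suc zero)    = -cong _ _ _ _
  Δ↑-cong (suc (suc q)) = cong₂ _+_ (-cong _ _ _ _) (-cong _ _ _ _)

δ₀ : ℕ → ℚ
δ₀ zero    = 1ℚ
δ₀ (suc _) = 0ℚ

-- Δ-cong with potential-chart moves each vertex to the origin of a chart, where
-- the vertex equation is a polynomial identity; only at the ends does ℓ = L_{s+r}
-- enter, and there it is expanded in the same chart.
potential-harmonic : ∀ s r → let ℓ = ι (lucas (s ℕ.+ r)) in Q.Δ (potential ℓ) s r ≡ ι 5 * ℓ * (δ₀ s - δ₀ r)
potential-harmonic zero       zero       = refl
potential-harmonic zero       (suc zero) = refl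
potential-harmonic (suc zero) zero       = refl
potential-harmonic (suc zero) (suc zero) = refl
potential-harmonic zero (suc (suc q)) =
  trans (Δ-cong (potential-chart ℓ 0 q) 0 2) (first-vertex (ι (fib q)) (ι (fib (suc q))) ℓ (ι-lucas-+ 1 q))
  where
  ℓ = ι (lucas (2 ℕ.+ q))
  first-vertex : ∀ c d ℓ → ℓ ≡ lucasFrom _+_ c d 1 → Q.Δ (Q.chart ℓ (ι 0) (ι 0) (ι 1) c d) 0 2 ≡ ι 5 * ℓ * (1ℚ - 0ℚ)
  first-vertex c d _ refl = solve 2 (λ c d → let ℓ = lucasFrom _:+_ c d 1 in
    P.Δ (P.chart ℓ (con (ι 0)) (con (ι 0)) (con (ι 1)) c d) 0 2 := con (ι 5) :* ℓ :* (con 1ℚ :- con 0ℚ)) refl c d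
potential-harmonic (suc zero) (suc (suc q)) =
  trans (Δ-cong (potential-chart ℓ 0 q) 1 2) (second-vertex (ι (fib q)) (ι (fib (suc q))) ℓ (ι-lucas-+ 2 q))
  where
  ℓ = ι (lucas (3 ℕ.+ q))
  second-vertex : ∀ c d ℓ → ℓ ≡ lucasFrom _+_ c d 2 → Q.Δ (Q.chart ℓ (ι 0) (ι 0) (ι 1) c d) 1 2 ≡ ι 5 * ℓ * (0ℚ - 0ℚ)
  second-vertex c d _ refl = solve 2 (λ c d → let ℓ = lucasFrom _:+_ c d 2 in
    P.Δ (P.chart ℓ (con (ι 0)) (con (ι 0)) (con (ι 1)) c d) 1 2 := con (ι 5) :* ℓ :* (con 0ℚ :- con 0ℚ)) refl c d
potential-harmonic (suc (suc p)) zero =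
  trans (Δ-cong (potential-chart ℓ p 0) 2 0) (last-vertex (ι p) (ι (fib p)) (ι (fib (suc p))) ℓ ℓ≡)
  where
  ℓ = ι (lucas (2 ℕ.+ p ℕ.+ 0))
  ℓ≡ : ℓ ≡ lucasFrom _+_ (ι (fib p)) (ι (fib (suc p))) 1
  ℓ≡ = trans (cong (λ m → ι (lucas (2 ℕ.+ m))) (ℕP.+-identityʳ p)) (ι-lucas-+ 1 p)
  last-vertex : ∀ σ a b ℓ → ℓ ≡ lucasFrom _+_ a b 1 → Q.Δ (Q.chart ℓ σ a b (ι 0) (ι 1)) 2 0 ≡ ι 5 * ℓ * (0ℚ - 1ℚ)
  last-vertex σ a b _ refl = solve 3 (λ σ a b → let ℓ = lucasFrom _:+_ a b 1 in
    P.Δ (P.chart ℓ σ a b (con (ι 0)) (con (ι 1))) 2 0 := con (ι 5) :* ℓ :* (con 0ℚ :- con 1ℚ)) refl σ a b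
potential-harmonic (suc (suc p)) (suc zero) =
  trans (Δ-cong (potential-chart ℓ p 0) 2 1) (penultimate-vertex (ι p) (ι (fib p)) (ι (fib (suc p))) ℓ ℓ≡)
  where
  ℓ = ι (lucas (2 ℕ.+ p ℕ.+ 1))
  ℓ≡ : ℓ ≡ lucasFrom _+_ (ι (fib p)) (ι (fib (suc p))) 2
  ℓ≡ = trans (cong (λ m → ι (lucas (2 ℕ.+ m))) (ℕP.+-comm p 1)) (ι-lucas-+ 2 p)
  penultimate-vertex : ∀ σ a b ℓ → ℓ ≡ lucasFrom _+_ a b 2 → Q.Δ (Q.chart ℓ σ a b (ι 0) (ι 1)) 2 1 ≡ ι 5 * ℓ * (0ℚ - 0ℚ)
  penultimate-vertex σ a b _ refl = solve 3 (λ σ a b → let ℓ = lucasFrom _:+_ a b 2 in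
    P.Δ (P.chart ℓ σ a b (con (ι 0)) (con (ι 1))) 2 1 := con (ι 5) :* ℓ :* (con 0ℚ :- con 0ℚ)) refl σ a b
potential-harmonic (suc (suc p)) (suc (suc q)) =
  trans (Δ-cong (potential-chart ℓ p q) 2 2) (interior-vertex ℓ (ι p) (ι (fib p)) (ι (fib (suc p))) (ι (fib q)) (ι (fib (suc q))))
  where
  ℓ = ι (lucas (2 ℕ.+ p ℕ.+ (2 ℕ.+ q)))
  interior-vertex : ∀ ℓ σ a b c d → Q.Δ (Q.chart ℓ σ a b c d) 2 2 ≡ ι 5 * ℓ * (0ℚ - 0ℚ)
  interior-vertex = solve 6 (λ ℓ σ a b c d →
    P.Δ (P.chart ℓ σ a b c d) 2 2 := con (ι 5) :* ℓ :* (con 0ℚ :- con 0ℚ)) refl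

-- The potential on G_{N+1} and the resistance between its end vertices

pathPotential : ℕ → ℕ → ℚ
pathPotential N t = potential (ι (lucas N)) t (N ∸ t)

+-shift : ∀ d m n → d ℕ.+ m ℕ.+ n ≡ m ℕ.+ (d ℕ.+ n)
+-shift d m n = trans (cong (ℕ._+ n) (ℕP.+-comm d m)) (ℕP.+-assoc m d n)

pathPotential-at : ∀ {N} t u → t ℕ.+ u ≡ N → pathPotential N t ≡ potential (ι (lucas N)) t u
pathPotential-at t u refl = cong (potential _ t) (ℕP.m+n∸m≡n t u)

below-pathPotential : ∀ s r → below s (λ t → pathPotential (s ℕ.+ r) s - pathPotential (s ℕ.+ r) t) ≡ Q.Δ↓ (potential (ι (lucas (s ℕ.+ r)))) s r
below-pathPotential zero          r = refl
below-pathPotential (suc zero)    r = refl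
below-pathPotential (suc (suc p)) r = cong₂ _+_
  (cong₂ _-_ centre (pathPotential-at p (2 ℕ.+ r) (sym (+-shift 2 p r))))
  (cong₂ _-_ centre (pathPotential-at (suc p) (suc r) (sym (+-shift 1 (suc p) r))))
  where centre = pathPotential-at (2 ℕ.+ p) r refl

above-pathPotential : ∀ s r → above r (λ t → pathPotential (s ℕ.+ r) s - pathPotential (s ℕ.+ r) (t ℕ.+ s)) ≡ Q.Δ↑ (potential (ι (lucas (s ℕ.+ r)))) s r
above-pathPotential s zero          = refl
above-pathPotential s (suc zero)    = cong₂ _-_ (pathPotential-at s 1 refl) (pathPotential-at (suc s) 0 (+-shift 1 s 0))
above-pathPotential s (suc (suc q)) = cong₂ _+_
  (cong₂ _-_ centre (pathPotential-at (suc s) (suc q) (+-shift 1 s (suc q))))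
  (cong₂ _-_ centre (pathPotential-at (2 ℕ.+ s) q (+-shift 2 s q)))
  where centre = pathPotential-at s (2 ℕ.+ q) refl

pathPotential-vertex : ∀ s r {N} → s ℕ.+ r ≡ N
  → below s (λ t → pathPotential N s - pathPotential N t) + above r (λ t → pathPotential N s - pathPotential N (t ℕ.+ s)) ≡ ι 5 * ι (lucas N) * (δ₀ s - δ₀ r)
pathPotential-vertex s r refl = trans (cong₂ _+_ (below-pathPotential s r) (above-pathPotential s r)) (potential-harmonic s r)

e-zero : ∀ {n} (i : Fin (suc n)) → e zero i ≡ δ₀ (toℕ i)
e-zero zero    = refl
e-zero (suc i) = refl

e-fromℕ : ∀ N (i : Fin (suc N)) → e (fromℕ N) i ≡ δ₀ (N ∸ toℕ i)
e-fromℕ zero    zero    = refl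
e-fromℕ (suc N) zero    = refl
e-fromℕ (suc N) (suc i) = trans (e-suc (fromℕ N) i) (e-fromℕ N i)

laplacian-pathPotential : ∀ N (i : Fin (suc N))
  → (laplacian (suc N) *ᵥ (λ j → pathPotential N (toℕ j))) i ≡ ι 5 * ι (lucas N) * (e zero i - e (fromℕ N) i)
laplacian-pathPotential N i = begin
  (laplacian (suc N) *ᵥ (λ j → Y (toℕ j))) i             ≡⟨ laplacian-*ᵥ (λ j → Y (toℕ j)) i ⟩
  sum {suc N} (λ j → band s (toℕ j) * h (toℕ j))           ≡⟨ sum-band s r s+r≡N h ⟩
  below s h + above r (λ t → h (t ℕ.+ s))                  ≡⟨ pathPotential-vertex s r s+r≡N ⟩
  ι 5 * ι (lucas N) * (δ₀ s - δ₀ r)                        ≡⟨ cong (ι 5 * ι (lucas N) *_) (sym (cong₂ _-_ (e-zero i) (e-fromℕ N i))) ⟩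
  ι 5 * ι (lucas N) * (e zero i - e (fromℕ N) i)           ∎
  where
  open ≡-Reasoning
  Y = pathPotential N
  s = toℕ i
  r = N ∸ s
  h = λ t → Y s - Y t
  s+r≡N = ℕP.m+[n∸m]≡n (FinP.toℕ≤pred[n] i)

resistance-closed-form : ∀ N (Ldag : Matrix (suc N)) → IsMoorePenroseInverse (laplacian (suc N)) Ldag
  → resistance Ldag zero (fromℕ N) ≡ frac N 5 _ + frac (4 ℕ.* fib N) (5 ℕ.* lucas N) (five*lucas-nonZero N)
resistance-closed-form N Ldag mp = begin
  quadForm Ldag b                          ≡⟨ quadForm-pseudoinverse L Ldag x b (laplacian-sym (suc N)) (IsMoorePenroseInverse.penrose1 mp) Lx≡b ⟩
  ⟨ x , b ⟩                                ≡⟨ ⟨,e-e⟩ x zero (fromℕ N) ⟩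
  c * Y 0 - c * Y (toℕ (fromℕ N))          ≡⟨ cong (λ y → c * potential ℓ 0 N - c * y) Y-last ⟩
  c * potential ℓ 0 N - c * potential ℓ N 0 ≡⟨ ends ℓ (ι N) (ι (fib N)) (ι (fib (suc N))) c ⟩
  c * ℓ * ι N + c * (ι 4 * ι (fib N))      ≡⟨ cong₂ (λ u v → u * ι N + c * v) c*ℓ≡⅕ (sym (ι-homo-* 4 (fib N))) ⟩
  frac 1 5 _ * ι N + c * ι (4 ℕ.* fib N)   ≡⟨ cong₂ _+_ (frac-1-*-ι N 5 _) (frac-1-*-ι (4 ℕ.* fib N) (5 ℕ.* lucas N) nz) ⟩
  frac N 5 _ + frac (4 ℕ.* fib N) (5 ℕ.* lucas N) nz ∎
  where
  open ≡-Reasoning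
  L = laplacian (suc N)
  ℓ = ι (lucas N)
  nz = five*lucas-nonZero N
  c = frac 1 (5 ℕ.* lucas N) nz
  Y = pathPotential N
  x : Fin (suc N) → ℚ
  x j = c * Y (toℕ j)
  b : Fin (suc N) → ℚ
  b k = e zero k - e (fromℕ N) k
  c*5ℓ≡1 : c * (ι 5 * ℓ) ≡ 1ℚ
  c*5ℓ≡1 = trans (cong (c *_) (sym (ι-homo-* 5 (lucas N))))
                 (trans (frac-1-*-ι (5 ℕ.* lucas N) (5 ℕ.* lucas N) nz) (frac-cross (5 ℕ.* lucas N) (5 ℕ.* lucas N) 1 1 nz _ (ℕP.*-comm (5 ℕ.* lucas N) 1)))
  c*ℓ≡⅕ : c * ℓ ≡ frac 1 5 _
  c*ℓ≡⅕ = trans (frac-1-*-ι (lucas N) (5 ℕ.* lucas N) nz) (frac-cross (lucas N) (5 ℕ.* lucas N) 1 5 nz _ (trans (ℕP.*-comm (lucas N) 5) (sym (ℕP.*-identityˡ _))))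
  Lx≡b : ∀ i → (L *ᵥ x) i ≡ b i
  Lx≡b i = begin
    (L *ᵥ x) i                      ≡⟨ *ᵥ-*ˡ L c (λ j → Y (toℕ j)) i ⟩
    c * (L *ᵥ (λ j → Y (toℕ j))) i  ≡⟨ cong (c *_) (laplacian-pathPotential N i) ⟩
    c * (ι 5 * ℓ * b i)             ≡⟨ sym (ℚP.*-assoc c (ι 5 * ℓ) (b i)) ⟩
    c * (ι 5 * ℓ) * b i             ≡⟨ cong (_* b i) c*5ℓ≡1 ⟩
    1ℚ * b i                        ≡⟨ ℚP.*-identityˡ (b i) ⟩
    b i                             ∎
  Y-last : Y (toℕ (fromℕ N)) ≡ potential ℓ N 0
  Y-last = trans (cong Y (FinP.toℕ-fromℕ N)) (pathPotential-at N 0 (ℕP.+-identityʳ N))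
  ends : ∀ ℓ σ f f′ c → c * Q.potentialFormula ℓ (ι 0) (ι 0) (ι 1) f f′ - c * Q.potentialFormula ℓ σ f f′ (ι 0) (ι 1)
                        ≡ c * ℓ * σ + c * (ι 4 * f)
  ends = solve 5 (λ ℓ σ f f′ c →
    c :* P.potentialFormula ℓ (con (ι 0)) (con (ι 0)) (con (ι 1)) f f′ :- c :* P.potentialFormula ℓ σ f f′ (con (ι 0)) (con (ι 1))
      := (c :* ℓ) :* σ :+ c :* (con (ι 4) :* f)) refl

-- The closed form equals the series

closedForm : ℕ → ℚ
closedForm k = frac (2 ℕ.+ k) 5 _ + frac (4 ℕ.* fib (2 ℕ.+ k)) (5 ℕ.* lucas (2 ℕ.+ k)) (five*lucas-nonZero (2 ℕ.+ k))

leadingTerm : ℕ → ℚ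
leadingTerm k = frac (2 ℕ.* (fib (2 ℕ.+ k) ℕ.* fib (2 ℕ.+ k))) (lucas (2 ℕ.+ k) ℕ.* lucas (1 ℕ.+ k)) (lucas*lucas-nonZero (2 ℕ.+ k) (1 ℕ.+ k))

seriesTerm : ℕ → ℚ
seriesTerm i = frac (fib i ℕ.* fib (suc i)) (lucas i ℕ.* lucas (suc i)) (lucas*lucas-nonZero i (suc i))

-- Numerators and denominators, as produced by frac-+, of both sides of
-- closedForm-step; a = F_k and b = F_{k+1}.
module FractionSums {c l} (R : RawSemiring c l) (ι′ : ℕ → RawSemiring.Carrier R) (k a b : RawSemiring.Carrier R) where
  open RawSemiring R using (Carrier) renaming (_+_ to _⊕_; _*_ to _⊛_)

  infixl 6 _⊞_
  _⊞_ : Carrier × Carrier → Carrier × Carrier → Carrier × Carrier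
  (x , y) ⊞ (u , v) = x ⊛ v ⊕ u ⊛ y , y ⊛ v

  F L : ℕ → Carrier
  F = fibFrom _⊕_ a b
  L = lucasFrom _⊕_ a b

  closed leading : ℕ → Carrier × Carrier
  closed j  = (ι′ (2 ℕ.+ j) ⊕ k , ι′ 5) ⊞ (ι′ 4 ⊛ F (2 ℕ.+ j) , ι′ 5 ⊛ L (1 ℕ.+ j))
  leading j = ι′ 2 ⊛ (F (2 ℕ.+ j) ⊛ F (2 ℕ.+ j)) , L (1 ℕ.+ j) ⊛ L j

  lhs rhs : Carrier × Carrier
  lhs = closed 1 ⊞ leading 0
  rhs = closed 0 ⊞ leading 1 ⊞ (F 1 ⊛ F 2 , L 0 ⊛ L 1)

module ℕ-Poly = ℕ-Solver.+-*-Solver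

ℕ-polynomialSemiring : ℕ → RawSemiring 0ℓ 0ℓ
ℕ-polynomialSemiring n = record
  { Carrier = ℕ-Poly.Polynomial n ; _≈_ = _≡_ ; _+_ = ℕ-Poly._:+_ ; _*_ = ℕ-Poly._:*_ ; 0# = ℕ-Poly.con 0 ; 1# = ℕ-Poly.con 1 }

closedForm-step : ∀ k → closedForm (suc k) + leadingTerm k ≡ closedForm k + leadingTerm (suc k) + seriesTerm (suc k)
closedForm-step k = begin
  closedForm (suc k) + leadingTerm k
    ≡⟨ cong (_+ leadingTerm k) (frac-+ (3 ℕ.+ k) 5 (4 ℕ.* fib (3 ℕ.+ k)) (5 ℕ.* lucas (3 ℕ.+ k)) _ nz₃) ⟩
  frac (proj₁ (closed 1)) (proj₂ (closed 1)) nzC₁ + leadingTerm k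
    ≡⟨ frac-+ (proj₁ (closed 1)) (proj₂ (closed 1)) (proj₁ (leading 0)) (proj₂ (leading 0)) nzC₁ nzA₀ ⟩
  frac (proj₁ lhs) (proj₂ lhs) (*-nonZero nzC₁ nzA₀)
    ≡⟨ frac-cross (proj₁ lhs) (proj₂ lhs) (proj₁ rhs) (proj₂ rhs) (*-nonZero nzC₁ nzA₀) (*-nonZero (*-nonZero nzC₀ nzA₁) nzB₁) cross-multiplied ⟩
  frac (proj₁ rhs) (proj₂ rhs) (*-nonZero (*-nonZero nzC₀ nzA₁) nzB₁)
    ≡⟨ sym (frac-+ (proj₁ (closed 0 ⊞ leading 1)) (proj₂ (closed 0 ⊞ leading 1)) (fib (1 ℕ.+ k) ℕ.* fib (2 ℕ.+ k)) (lucas (1 ℕ.+ k) ℕ.* lucas (2 ℕ.+ k)) (*-nonZero nzC₀ nzA₁) nzB₁) ⟩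
  frac (proj₁ (closed 0 ⊞ leading 1)) (proj₂ (closed 0 ⊞ leading 1)) (*-nonZero nzC₀ nzA₁) + seriesTerm (suc k)
    ≡⟨ cong (_+ seriesTerm (suc k)) (sym (frac-+ (proj₁ (closed 0)) (proj₂ (closed 0)) (proj₁ (leading 1)) (proj₂ (leading 1)) nzC₀ nzA₁)) ⟩
  frac (proj₁ (closed 0)) (proj₂ (closed 0)) nzC₀ + leadingTerm (suc k) + seriesTerm (suc k)
    ≡⟨ cong (λ z → z + leadingTerm (suc k) + seriesTerm (suc k)) (sym (frac-+ (2 ℕ.+ k) 5 (4 ℕ.* fib (2 ℕ.+ k)) (5 ℕ.* lucas (2 ℕ.+ k)) _ nz₂)) ⟩
  closedForm k + leadingTerm (suc k) + seriesTerm (suc k) ∎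
  where
  open ≡-Reasoning
  open FractionSums ℕ.+-*-rawSemiring (λ m → m) k (fib k) (fib (suc k))
  nz₂ = five*lucas-nonZero (2 ℕ.+ k)
  nz₃ = five*lucas-nonZero (3 ℕ.+ k)
  nzC₀ : NonZero (5 ℕ.* (5 ℕ.* lucas (2 ℕ.+ k)))
  nzC₀ = *-nonZero {5} _ nz₂
  nzC₁ : NonZero (5 ℕ.* (5 ℕ.* lucas (3 ℕ.+ k)))
  nzC₁ = *-nonZero {5} _ nz₃
  nzA₀ = lucas*lucas-nonZero (2 ℕ.+ k) (1 ℕ.+ k)
  nzA₁ = lucas*lucas-nonZero (3 ℕ.+ k) (2 ℕ.+ k)
  nzB₁ = lucas*lucas-nonZero (1 ℕ.+ k) (2 ℕ.+ k)
  cross-multiplied : proj₁ lhs ℕ.* proj₂ rhs ≡ proj₁ rhs ℕ.* proj₂ lhs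
  cross-multiplied = ℕ-Poly.solve 3 (λ k a b →
    let l = FractionSums.lhs (ℕ-polynomialSemiring 3) ℕ-Poly.con k a b
        r = FractionSums.rhs (ℕ-polynomialSemiring 3) ℕ-Poly.con k a b
    in proj₁ l ℕ-Poly.:* proj₂ r ℕ-Poly.:= proj₁ r ℕ-Poly.:* proj₂ l) refl k (fib k) (fib (suc k))

closedForm≡series : ∀ k → closedForm k ≡ leadingTerm k + sumFrom1 k seriesTerm
closedForm≡series zero    = refl
closedForm≡series (suc k) = begin
  closedForm (suc k)                                   ≡⟨ solve 2 (λ x y → x := x :+ y :- y) refl (closedForm (suc k)) (leadingTerm k) ⟩
  closedForm (suc k) + leadingTerm k - leadingTerm k   ≡⟨ cong (_- leadingTerm k) (closedForm-step k) ⟩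
  closedForm k + A₁ + B₁ - leadingTerm k               ≡⟨ cong (λ z → z + A₁ + B₁ - leadingTerm k) (closedForm≡series k) ⟩
  leadingTerm k + S + A₁ + B₁ - leadingTerm k          ≡⟨ solve 4 (λ a s a₁ b₁ → a :+ s :+ a₁ :+ b₁ :- a := a₁ :+ (s :+ b₁)) refl (leadingTerm k) S A₁ B₁ ⟩
  A₁ + (S + B₁)                                        ∎
  where
  open ≡-Reasoning
  A₁ = leadingTerm (suc k)
  B₁ = seriesTerm (suc k)
  S = sumFrom1 k seriesTerm

theorem3p4 : (k : ℕ) → (Ldag : Matrix (suc (suc (suc k))))
  → IsMoorePenroseInverse (laplacian (suc (suc (suc k)))) Ldag
  → (resistance Ldag zero (fromℕ (suc (suc k)))
      ≡ frac (2 Data.Nat.* (fib (suc (suc k)) Data.Nat.* fib (suc (suc k)))) (lucas (suc (suc k)) Data.Nat.* lucas (suc k)) (lucas*lucas-nonZero (suc (suc k)) (suc k))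
        + sumFrom1 k (λ i → frac (fib i Data.Nat.* fib (suc i)) (lucas i Data.Nat.* lucas (suc i)) (lucas*lucas-nonZero i (suc i))))
    × (resistance Ldag zero (fromℕ (suc (suc k)))
      ≡ frac (suc (suc k)) 5 _ + frac (4 Data.Nat.* fib (suc (suc k))) (5 Data.Nat.* lucas (suc (suc k))) (five*lucas-nonZero (suc (suc k))))
theorem3p4 k Ldag mp = trans r (closedForm≡series k) , r
  where r = resistance-closed-form (suc (suc k)) Ldag mp
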